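{- Let $R$ be a $\mathbb{U}_{\mathrm{opt}}$-LL eDCTRS over a signature $\mathcal{F}$ which is non-LV or non-RV. Then $\mathbb{U}_{\mathrm{opt}}$ is sound for $R$ with respect to EV-safe reduction, i.e., for all $s,t\in T(\mathcal{F},\mathcal{V})$, if $s\to^*_{\mathrm{evs},\mathbb{U}_{\mathrm{opt}}(R)}t$ then $s\to^*_Rt$.
   Context: Terms $T(\mathcal{F},\mathcal{V})$, $\mathrm{Var}(\cdot)$ variables occurring, $\mathrm{Pos}_{\mathcal{F}}(t)$/$\mathrm{Pos}_{\mathcal{V}}(t)$ function-symbol/variable positions, $t|_p$ subterm, $p\le q$ prefix order; linear term: no variable twice. Extended conditional rule $\rho: l\to r\Leftarrow s_1\twoheadrightarrow t_1;\dots;s_k\twoheadrightarrow t_k$ ($l$ may be a variable); eCTRS = set of such rules with rewrite relation $\to_R=\bigcup_n\to_{(n),R}$, $\to_{(0),R}=\emptyset$, $\to_{(i+1),R}=\{(C[l\sigma],C[r\sigma])\mid s_j\sigma\to^*_{(i),R}t_j\sigma\ \forall j\}$; eTRS: unconditional rules only (extra variables allowed). Deterministic: $\mathrm{Var}(s_i)\subseteq\mathrm{Var}(l,t_1,\dots,t_{i-1})$; eDCTRS: all rules deterministic (extra variables in $r$ allowed). Non-LV: $l\notin\mathcal{V}$; non-RV: $r\notin\mathcal{V}$; a rule set has a property if all rules do. Optimized unraveling: for $k\ge1$, $X_i=\mathrm{Var}(l,t_1,\dots,t_{i-1})$, $Y_i=\mathrm{Var}(r,t_i,s_{i+1},t_{i+1},\dots,s_k,t_k)$,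 $Z_i=X_i\cap Y_i$, $\overrightarrow{X}$ a fixed listing of a finite set $X$, fresh $U^\rho_1,\dots,U^\rho_k$; $\mathbb{U}_{\mathrm{opt}}(\rho)=\{l\to U^\rho_1(s_1,\overrightarrow{Z_1})\}\cup\{U^\rho_i(t_i,\overrightarrow{Z_i})\to U^\rho_{i+1}(s_{i+1},\overrightarrow{Z_{i+1}})\mid1\le i<k\}\cup\{U^\rho_k(t_k,\overrightarrow{Z_k})\to r\}$, unconditional rules kept, $\mathbb{U}_{\mathrm{opt}}(R)$ the union. $R$ is $\mathbb{U}_{\mathrm{opt}}$-LL if every rule of $\mathbb{U}_{\mathrm{opt}}(R)$ has a linear left-hand side. EV-safe reduction of an eTRS $S$: for $t_0\to_{p_1,l_1\to r_1}t_1\to_{p_2,l_2\to r_2}\cdots$ put $B_0=\mathrm{Pos}_{\mathcal{F}}(t_0)$, $B_i=(B_{i-1}\setminus\{q\in B_{i-1}\mid q\ge p_i\})\cup\{p_iq\mid q\in\mathrm{Pos}_{\mathcal{F}}(r_i)\}\cup\{p_ip'q\mid p_ipq\in B_{i-1},p\in\mathrm{Pos}_{\mathcal{V}}(l_i),l_i|_p=r_i|_{p'}\}$; the sequence is EV-safe if $p_i\in B_{i-1}$ for all $i$; $s\to^*_{\mathrm{evs},S}t$ if a finite EV-safe sequence from $s$ to $t$ exists. -}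

module Defs where

open import Data.Nat using (ℕ; zero; suc; _≟_)
open import Data.List using (List; []; _∷_; _++_; length; concatMap; take; drop; filter; deduplicate; map)
open import Data.List.Membership.Propositional using (_∈_)
open import Data.List.Membership.DecPropositional _≟_ using (_∈?_)
open import Data.List.Relation.Unary.All using (All)
open import Data.List.Relation.Unary.Unique.Propositional using (Unique)
open import Data.Maybe using (Maybe; just; nothing)
open import Data.Product using (Σ; ∃; ∃-syntax; _×_; _,_; proj₁; proj₂)
open import Data.Sum using (_⊎_; inj₁; inj₂)
open import Data.Empty using (⊥)
open import Relation.Nullary using (¬_)
open import Relation.Binary.PropositionalEquality using (_≡_)
open import Relation.Binary.Construct.Closure.ReflexiveTransitive using (Star)

data Term (F : Set) : Set where
  var : ℕ → Term F
  fun : F → List (Term F) → Term F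

-- positions (argument indices are 0-based)
Pos : Set
Pos = List ℕ

_≤ₚ_ : Pos → Pos → Set
p ≤ₚ q = ∃[ r ] (q ≡ p ++ r)

module _ {F : Set} where

  -- Var(t), as a list (possibly with repetitions)
  mutual
    vars : Term F → List ℕ
    vars (var x)    = x ∷ []
    vars (fun f ts) = varsL ts

    varsL : List (Term F) → List ℕ
    varsL []       = []
    varsL (t ∷ ts) = vars t ++ varsL ts

  Linear : Term F → Set
  Linear t = Unique (vars t)

  IsVar : Term F → Set
  IsVar t = ∃[ x ] (t ≡ var x)

  Subst : Set
  Subst = ℕ → Term F

  mutual
    _⟨_⟩ : Term F → Subst → Term F
    var x    ⟨ σ ⟩ = σ x
    fun f ts ⟨ σ ⟩ = fun f (substL ts σ)

    substL : List (Term F) → Subst → List (Term F)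
    substL []       σ = []
    substL (t ∷ ts) σ = (t ⟨ σ ⟩) ∷ substL ts σ

  mutual
    _∣_ : Term F → Pos → Maybe (Term F)
    t        ∣ []      = just t
    var x    ∣ (i ∷ p) = nothing
    fun f ts ∣ (i ∷ p) = argAt ts i p

    argAt : List (Term F) → ℕ → Pos → Maybe (Term F)
    argAt []       i       p = nothing
    argAt (u ∷ us) zero    p = u ∣ p
    argAt (u ∷ us) (suc i) p = argAt us i p

  PosF : Term F → Pos → Set
  PosF t p = ∃[ f ] ∃[ ts ] (t ∣ p ≡ just (fun f ts))

  PosV : Term F → Pos → Set
  PosV t p = ∃[ x ] (t ∣ p ≡ just (var x))

  data CtxAt (Rl : Term F → Term F → Set) : Pos → Term F → Term F → Set where
    root : ∀ {s t} → Rl s t → CtxAt Rl [] s t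
    arg  : ∀ {p u v} (f : F) (pre post : List (Term F)) → CtxAt Rl p u v →
           CtxAt Rl (length pre ∷ p) (fun f (pre ++ u ∷ post)) (fun f (pre ++ v ∷ post))

  Ctx : (Term F → Term F → Set) → Term F → Term F → Set
  Ctx Rl s t = ∃[ p ] CtxAt Rl p s t

record CRule (F : Set) : Set where
  constructor _⇒_⇐_
  field
    lhs   : Term F
    rhs   : Term F
    conds : List (Term F × Term F)
open CRule public

-- an eCTRS is a (possibly infinite) set of extended conditional rules
CTRS : Set → Set₁
CTRS F = CRule F → Set

-- an eTRS (unconditional rules, extra variables allowed): set of pairs l → r
TRS : Set → Set₁
TRS F = Term F → Term F → Set

module _ {F : Set} where

  X : CRule F → ℕ → List ℕ
  X ρ j = vars (lhs ρ) ++ concatMap (λ c → vars (proj₂ c)) (take j (conds ρ))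

  Deterministic : CRule F → Set
  Deterministic ρ = ∀ pre s t post → conds ρ ≡ pre ++ (s , t) ∷ post →
                    ∀ x → x ∈ vars s → x ∈ X ρ (length pre)

  IsEDCTRS : CTRS F → Set
  IsEDCTRS R = ∀ ρ → R ρ → Deterministic ρ

  NonLV : CTRS F → Set
  NonLV R = ∀ ρ → R ρ → ¬ IsVar (lhs ρ)

  NonRV : CTRS F → Set
  NonRV R = ∀ ρ → R ρ → ¬ IsVar (rhs ρ)

  mutual
    StepN : CTRS F → ℕ → Term F → Term F → Set
    StepN R zero    s t = ⊥
    StepN R (suc n) s t = Ctx (RootN R n) s t

    RootN : CTRS F → ℕ → Term F → Term F → Set
    RootN R n s t = ∃[ ρ ] ∃[ σ ] (R ρ × s ≡ lhs ρ ⟨ σ ⟩ × t ≡ rhs ρ ⟨ σ ⟩ ×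
                      All (λ c → Star (StepN R n) (proj₁ c ⟨ σ ⟩) (proj₂ c ⟨ σ ⟩)) (conds ρ))

  _⊢_⟶_ : CTRS F → Term F → Term F → Set
  R ⊢ s ⟶ t = ∃[ n ] StepN R n s t

  _⊢_⟶*_ : CTRS F → Term F → Term F → Set
  R ⊢ s ⟶* t = Star (R ⊢_⟶_) s t

-- Optimized unraveling.  The fresh symbols U^ρ_i are  inj₂ (ρ , i-1)
-- (0-based index), disjoint from F and from each other.

USym : Set → Set
USym F = F ⊎ (CRule F × ℕ)

module _ {F : Set} where

  mutual
    emb : Term F → Term (USym F)
    emb (var x)    = var x
    emb (fun f ts) = fun (inj₁ f) (embL ts)

    embL : List (Term F) → List (Term (USym F))
    embL []       = []
    embL (t ∷ ts) = emb t ∷ embL ts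

  -- Y_i = Var(r, t_i, s_{i+1}, t_{i+1}, …, s_k, t_k)  (j = i-1)
  Y : CRule F → ℕ → List ℕ
  Y ρ j = vars (rhs ρ)
          ++ concatMap (λ c → vars (proj₂ c)) (take 1 (drop j (conds ρ)))
          ++ concatMap (λ c → vars (proj₁ c) ++ vars (proj₂ c)) (drop (suc j) (conds ρ))

  -- a fixed listing of Z_i = X_i ∩ Y_i (without repetitions)
  Z : CRule F → ℕ → List ℕ
  Z ρ j = deduplicate _≟_ (filter (λ x → x ∈? Y ρ j) (X ρ j))

  U : CRule F → ℕ → Term F → Term (USym F)
  U ρ j u = fun (inj₂ (ρ , j)) (emb u ∷ map var (Z ρ j))


  data Uopt (R : CTRS F) : Term (USym F) → Term (USym F) → Set where
    keep  : ∀ {ρ} → R ρ → conds ρ ≡ [] → Uopt R (emb (lhs ρ)) (emb (rhs ρ))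
    first : ∀ {ρ} s t post → R ρ → conds ρ ≡ (s , t) ∷ post →
            Uopt R (emb (lhs ρ)) (U ρ 0 s)
    mid   : ∀ {ρ} pre s t s' t' post → R ρ →
            conds ρ ≡ pre ++ (s , t) ∷ (s' , t') ∷ post →
            Uopt R (U ρ (length pre) t) (U ρ (suc (length pre)) s')
    last  : ∀ {ρ} pre s t → R ρ → conds ρ ≡ pre ++ (s , t) ∷ [] →
            Uopt R (U ρ (length pre) t) (emb (rhs ρ))

  UoptLL : CTRS F → Set
  UoptLL R = ∀ l r → Uopt R l r → Linear l

module _ {G : Set} where

  StepAt : Pos → Term G → Term G → Term G → Term G → Set
  StepAt p l r s t = CtxAt (λ u v → ∃[ σ ] (u ≡ l ⟨ σ ⟩ × v ≡ r ⟨ σ ⟩)) p s t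

  nextB : (Pos → Set) → Pos → Term G → Term G → Pos → Set
  nextB B p l r q =
      (B q × ¬ (p ≤ₚ q))
    ⊎ (∃[ q' ] (q ≡ p ++ q' × PosF r q'))
    ⊎ (∃[ pv ] ∃[ p' ] ∃[ q' ] (q ≡ p ++ p' ++ q' × B (p ++ pv ++ q') ×
                                PosV l pv × l ∣ pv ≡ r ∣ p'))

  data EVS (S : TRS G) : (Pos → Set) → Term G → Term G → Set₁ where
    done : ∀ {B t} → EVS S B t t
    step : ∀ {B s s' t} p l r → S l r → StepAt p l r s s' → B p →
           EVS S (nextB B p l r) s' t → EVS S B s t

  _⊢_⟶*evs_ : TRS G → Term G → Term G → Set₁
  S ⊢ s ⟶*evs t = EVS S (PosF s) s t

module Submission where

-- The proof is a forward simulation.  Rel B u v  relates a term u of U_opt(R),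
-- whose EV-safe positions are B, to an R-term v: F-symbols correspond
-- homomorphically, a term  U^ρ_j(u₀, u⃗)  stands for  lhs ρ ⟨σ⟩  where σ satisfies
-- the first j conditions and  s_j σ, σ(Z_j)  reduce to the terms related to u₀, u⃗,
-- and a subterm without EV-safe positions is frozen and may stand for anything.
-- After facts on lists, positions, the rewrite relation of R and the sets X_j,
-- Y_j, Z_j, the relation is decomposed along linear patterns; simulate-step
-- then matches one EV-safe step by finitely many R-steps (U_opt-LL permits the
-- decomposition, determinism the extension of σ once a condition is met,
-- EV-safety freezes everything below extra variables).  Iterating it yields the
-- theorem.

open import Defs
open import Data.Nat using (ℕ; zero; suc; _+_; _≤_; _<_; _⊔_; _≟_; z≤n; s≤s; _≤′_; ≤′-reflexive; ≤′-step)
open import Data.Nat.Properties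
  using (+-suc; +-identityʳ; +-comm; m≤m⊔n; m≤n⊔m; ≤⇒≤′; <⇒≢; >⇒≢; <⇒≤; m<m+n; ≤-refl; suc-injective)
open import Data.List using (List; []; _∷_; _++_; length; concatMap; take; drop; map)
open import Data.List.Properties using (++-cancelˡ; ++-identityʳ; ++-assoc; ∷-injective; length-++)
open import Data.List.Membership.Propositional using (_∈_; _∉_)
open import Data.List.Membership.Propositional.Properties using (∈-++⁺ˡ; ∈-++⁺ʳ; ∈-++⁻; ∈-filter⁺; ∈-filter⁻)
open import Data.List.Membership.DecPropositional _≟_ using (_∈?_)
open import Data.List.Relation.Unary.Any using (here; there)
import Data.List.Relation.Unary.Any.Properties as AnyP
open import Data.List.Relation.Unary.All using (All; []; _∷_)
import Data.List.Relation.Unary.All as All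
import Data.List.Relation.Unary.All.Properties as AllP
open import Data.List.Relation.Unary.Unique.Propositional using (Unique)
open import Data.List.Relation.Unary.AllPairs using ([]; _∷_)
open import Data.List.Relation.Binary.Pointwise using (Pointwise; []; _∷_)
import Data.List.Relation.Binary.Pointwise as Pointwise
open import Data.Maybe using (just)
open import Data.Product using (Σ; ∃-syntax; _×_; _,_; proj₁; proj₂)
open import Data.Sum using (_⊎_; inj₁; inj₂)
open import Data.Empty using (⊥; ⊥-elim)
open import Relation.Nullary using (¬_; yes; no)
open import Relation.Binary.PropositionalEquality using (_≡_; refl; sym; trans; cong; cong₂; subst; subst₂)
open import Relation.Binary.Construct.Closure.ReflexiveTransitive using (Star; ε; _◅_; _◅◅_)
import Relation.Binary.Construct.Closure.ReflexiveTransitive as Star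

module _ {A : Set} where

  unique-++ˡ : (xs : List A) {ys : List A} → Unique (xs ++ ys) → Unique xs
  unique-++ˡ []       _        = []
  unique-++ˡ (x ∷ xs) (x∉ ∷ u) = AllP.++⁻ˡ xs x∉ ∷ unique-++ˡ xs u

  unique-++ʳ : (xs : List A) {ys : List A} → Unique (xs ++ ys) → Unique ys
  unique-++ʳ []       u       = u
  unique-++ʳ (x ∷ xs) (_ ∷ u) = unique-++ʳ xs u

  unique-disjoint : (xs : List A) {ys : List A} {x : A} → Unique (xs ++ ys) → x ∈ xs → x ∈ ys → ⊥
  unique-disjoint (z ∷ xs) (z∉ ∷ _) (here refl)  x∈ys = All.lookup (AllP.++⁻ʳ xs z∉) x∈ys refl
  unique-disjoint (z ∷ xs) (_ ∷ u)  (there x∈xs) x∈ys = unique-disjoint xs u x∈xs x∈ys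

  -- Two splittings  xs ++ a ∷ ys  with prefixes of equal length coincide;
  -- this identifies the condition a U-symbol refers to.
  split-unique : (xs xs' : List A) {a a' : A} {ys ys' : List A} → xs ++ a ∷ ys ≡ xs' ++ a' ∷ ys' →
                 length xs ≡ length xs' → xs ≡ xs' × a ≡ a' × ys ≡ ys'
  split-unique []       []        refl _  = refl , refl , refl
  split-unique (x ∷ xs) (x' ∷ xs') e    le with ∷-injective e
  ... | refl , e' with split-unique xs xs' e' (suc-injective le)
  ... | refl , refl , refl = refl , refl , refl

  length-snoc : (xs : List A) (a : A) → length (xs ++ a ∷ []) ≡ suc (length xs)
  length-snoc xs a = trans (length-++ xs) (+-comm (length xs) 1)

  drop-++ : (xs ys : List A) → drop (length xs) (xs ++ ys) ≡ ys
  drop-++ []       ys = refl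
  drop-++ (x ∷ xs) ys = drop-++ xs ys

  drop-++-∷ : (xs : List A) (y : A) (ys : List A) → drop (suc (length xs)) (xs ++ y ∷ ys) ≡ ys
  drop-++-∷ []       y ys = refl
  drop-++-∷ (x ∷ xs) y ys = drop-++-∷ xs y ys

module _ {G : Set} where

  mutual
    subterm-++ : (t : Term G) (p q : Pos) {s : Term G} → t ∣ p ≡ just s → t ∣ (p ++ q) ≡ s ∣ q
    subterm-++ t          []      q refl = refl
    subterm-++ (fun f ts) (i ∷ p) q e    = argAt-++ ts i p q e

    argAt-++ : (ts : List (Term G)) (i : ℕ) (p q : Pos) {s : Term G} →
               argAt ts i p ≡ just s → argAt ts i (p ++ q) ≡ s ∣ q
    argAt-++ (u ∷ us) zero    p q e = subterm-++ u p q e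
    argAt-++ (u ∷ us) (suc i) p q e = argAt-++ us i p q e

  prefix-comparable : (p₁ q₁ p₂ q₂ : Pos) → p₁ ++ q₁ ≡ p₂ ++ q₂ → p₂ ≤ₚ p₁ ⊎ p₁ ≤ₚ p₂
  prefix-comparable []       _  p₂       _  _ = inj₂ (p₂ , refl)
  prefix-comparable (i ∷ p₁) _  []       _  _ = inj₁ (i ∷ p₁ , refl)
  prefix-comparable (i ∷ p₁) q₁ (j ∷ p₂) q₂ e with ∷-injective e
  ... | refl , e' with prefix-comparable p₁ q₁ p₂ q₂ e'
  ... | inj₁ (d , refl) = inj₁ (d , refl)
  ... | inj₂ (d , refl) = inj₂ (d , refl)

  below-var : (t : Term G) (p d : Pos) {x : ℕ} {s : Term G} → t ∣ p ≡ just (var x) →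
              t ∣ (p ++ d) ≡ just s → d ≡ [] × s ≡ var x
  below-var t p d e e' with trans (sym (subterm-++ t p d e)) e'
  below-var t p [] e e' | refl = refl , refl

  no-fun-below-var : (t : Term G) (p q : Pos) {x : ℕ} {f : G} {us : List (Term G)} →
                     t ∣ p ≡ just (var x) → ¬ t ∣ (p ++ q) ≡ just (fun f us)
  no-fun-below-var t p q e e' with below-var t p q e e'
  ... | _ , ()

  var-occurrences-aligned : (t : Term G) (p₁ q₁ p₂ q₂ : Pos) {x y : ℕ} → t ∣ p₁ ≡ just (var x) →
                            t ∣ p₂ ≡ just (var y) → p₁ ++ q₁ ≡ p₂ ++ q₂ → p₁ ≡ p₂ × q₁ ≡ q₂ × x ≡ y
  var-occurrences-aligned t p₁ q₁ p₂ q₂ e₁ e₂ e with prefix-comparable p₁ q₁ p₂ q₂ e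
  ... | inj₁ (d , refl) with below-var t p₂ d e₂ e₁
  ...   | refl , refl rewrite ++-identityʳ p₂ = refl , ++-cancelˡ p₂ _ _ e , refl
  var-occurrences-aligned t p₁ q₁ p₂ q₂ e₁ e₂ e | inj₂ (d , refl) with below-var t p₁ d e₁ e₂
  ...   | refl , refl rewrite ++-identityʳ p₁ = refl , ++-cancelˡ p₁ _ _ e , refl

  mutual
    var-position⇒∈vars : (t : Term G) (p : Pos) {x : ℕ} → t ∣ p ≡ just (var x) → x ∈ vars t
    var-position⇒∈vars (var y)    []      refl = here refl
    var-position⇒∈vars (fun f ts) (i ∷ p) e    = var-argAt⇒∈varsL ts i p e

    var-argAt⇒∈varsL : (ts : List (Term G)) (i : ℕ) (p : Pos) {x : ℕ} →
                       argAt ts i p ≡ just (var x) → x ∈ varsL ts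
    var-argAt⇒∈varsL (u ∷ us) zero    p e = ∈-++⁺ˡ (var-position⇒∈vars u p e)
    var-argAt⇒∈varsL (u ∷ us) (suc i) p e = ∈-++⁺ʳ (vars u) (var-argAt⇒∈varsL us i p e)

  mutual
    ∈vars⇒var-position : (t : Term G) {x : ℕ} → x ∈ vars t → ∃[ p ] (t ∣ p ≡ just (var x))
    ∈vars⇒var-position (var y) (here refl) = [] , refl
    ∈vars⇒var-position (fun f ts) m with ∈varsL⇒var-argAt ts m
    ... | i , p , e = i ∷ p , e

    ∈varsL⇒var-argAt : (ts : List (Term G)) {x : ℕ} → x ∈ varsL ts → ∃[ i ] ∃[ p ] (argAt ts i p ≡ just (var x))
    ∈varsL⇒var-argAt (u ∷ us) m with ∈-++⁻ (vars u) m
    ... | inj₁ m' = let p , e = ∈vars⇒var-position u m' in zero , p , e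
    ... | inj₂ m' = let i , p , e = ∈varsL⇒var-argAt us m' in suc i , p , e

  mutual
    linear-position-unique : (t : Term G) (p₁ p₂ : Pos) {x : ℕ} → Linear t →
                             t ∣ p₁ ≡ just (var x) → t ∣ p₂ ≡ just (var x) → p₁ ≡ p₂
    linear-position-unique (var y)    []       []       u e₁ e₂ = refl
    linear-position-unique (fun f ts) (i ∷ p₁) (j ∷ p₂) u e₁ e₂ with linearL-position-unique ts i j p₁ p₂ u e₁ e₂
    ... | refl , refl = refl

    linearL-position-unique : (ts : List (Term G)) (i j : ℕ) (p₁ p₂ : Pos) {x : ℕ} → Unique (varsL ts) →
                              argAt ts i p₁ ≡ just (var x) → argAt ts j p₂ ≡ just (var x) → i ≡ j × p₁ ≡ p₂
    linearL-position-unique (t ∷ ts) zero zero p₁ p₂ u e₁ e₂ =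
      refl , linear-position-unique t p₁ p₂ (unique-++ˡ (vars t) u) e₁ e₂
    linearL-position-unique (t ∷ ts) zero (suc j) p₁ p₂ u e₁ e₂ =
      ⊥-elim (unique-disjoint (vars t) u (var-position⇒∈vars t p₁ e₁) (var-argAt⇒∈varsL ts j p₂ e₂))
    linearL-position-unique (t ∷ ts) (suc i) zero p₁ p₂ u e₁ e₂ =
      ⊥-elim (unique-disjoint (vars t) u (var-position⇒∈vars t p₂ e₂) (var-argAt⇒∈varsL ts i p₁ e₁))
    linearL-position-unique (t ∷ ts) (suc i) (suc j) p₁ p₂ u e₁ e₂
      with linearL-position-unique ts i j p₁ p₂ (unique-++ʳ (vars t) u) e₁ e₂
    ... | refl , refl = refl , refl

  mutual
    subst-agree : (t : Term G) {σ θ : Subst} → (∀ x → x ∈ vars t → σ x ≡ θ x) → t ⟨ σ ⟩ ≡ t ⟨ θ ⟩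
    subst-agree (var x)    h = h x (here refl)
    subst-agree (fun f ts) h = cong (fun f) (substL-agree ts h)

    substL-agree : (ts : List (Term G)) {σ θ : Subst} → (∀ x → x ∈ varsL ts → σ x ≡ θ x) →
                   substL ts σ ≡ substL ts θ
    substL-agree []       h = refl
    substL-agree (t ∷ ts) h =
      cong₂ _∷_ (subst-agree t (λ x m → h x (∈-++⁺ˡ m))) (substL-agree ts (λ x m → h x (∈-++⁺ʳ (vars t) m)))

  varsL-map-var : (zs : List ℕ) → varsL (map (var {G}) zs) ≡ zs
  varsL-map-var []       = refl
  varsL-map-var (z ∷ zs) = cong (z ∷_) (varsL-map-var zs)

module _ {F : Set} where

  mutual
    vars-emb : (t : Term F) → vars (emb t) ≡ vars t
    vars-emb (var x)    = refl
    vars-emb (fun f ts) = varsL-embL ts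

    varsL-embL : (ts : List (Term F)) → varsL (embL ts) ≡ varsL ts
    varsL-embL []       = refl
    varsL-embL (t ∷ ts) = cong₂ _++_ (vars-emb t) (varsL-embL ts)

  embL-map-var : (zs : List ℕ) → embL {F} (map var zs) ≡ map var zs
  embL-map-var []       = refl
  embL-map-var (z ∷ zs) = cong (var z ∷_) (embL-map-var zs)

  -- Erasure back to F-terms, replacing U-rooted subterms by a variable.
  -- It is a left inverse of emb and commutes with substitution; it only
  -- provides the R-term standing for frozen subterms.
  mutual
    erase : Term (USym F) → Term F
    erase (var x)           = var x
    erase (fun (inj₁ f) ts) = fun f (eraseL ts)
    erase (fun (inj₂ _) ts) = var 0

    eraseL : List (Term (USym F)) → List (Term F)
    eraseL []       = []
    eraseL (t ∷ ts) = erase t ∷ eraseL ts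

  mutual
    erase-emb : (t : Term F) → erase (emb t) ≡ t
    erase-emb (var x)    = refl
    erase-emb (fun f ts) = cong (fun f) (eraseL-embL ts)

    eraseL-embL : (ts : List (Term F)) → eraseL (embL ts) ≡ ts
    eraseL-embL []       = refl
    eraseL-embL (t ∷ ts) = cong₂ _∷_ (erase-emb t) (eraseL-embL ts)

  mutual
    erase-subst : (t : Term F) (τ : ℕ → Term (USym F)) → erase (emb t ⟨ τ ⟩) ≡ t ⟨ (λ x → erase (τ x)) ⟩
    erase-subst (var x)    τ = refl
    erase-subst (fun f ts) τ = cong (fun f) (eraseL-substL ts τ)

    eraseL-substL : (ts : List (Term F)) (τ : ℕ → Term (USym F)) →
                    eraseL (substL (embL ts) τ) ≡ substL ts (λ x → erase (τ x))
    eraseL-substL []       τ = refl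
    eraseL-substL (t ∷ ts) τ = cong₂ _∷_ (erase-subst t τ) (eraseL-substL ts τ)

module _ {F : Set} where

  varsRhs : List (Term F × Term F) → List ℕ
  varsRhs cs = concatMap (λ c → vars (proj₂ c)) cs

  varsBoth : List (Term F × Term F) → List ℕ
  varsBoth cs = concatMap (λ c → vars (proj₁ c) ++ vars (proj₂ c)) cs

  varsRhs-take-suc : ∀ j (cs : List (Term F × Term F)) {x} → x ∈ varsRhs (take j cs) → x ∈ varsRhs (take (suc j) cs)
  varsRhs-take-suc (suc j) []       m = m
  varsRhs-take-suc (suc j) (c ∷ cs) m with ∈-++⁻ (vars (proj₂ c)) m
  ... | inj₁ m' = ∈-++⁺ˡ m'
  ... | inj₂ m' = ∈-++⁺ʳ (vars (proj₂ c)) (varsRhs-take-suc j cs m')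

  varsRhs-take-split : ∀ (pre : List (Term F × Term F)) s t rest {x} → x ∈ vars t →
                       x ∈ varsRhs (take (suc (length pre)) (pre ++ (s , t) ∷ rest))
  varsRhs-take-split []       s t rest m = ∈-++⁺ˡ m
  varsRhs-take-split (c ∷ pre) s t rest m = ∈-++⁺ʳ (vars (proj₂ c)) (varsRhs-take-split pre s t rest m)

  X-mono : ∀ (ρ : CRule F) j {x} → x ∈ X ρ j → x ∈ X ρ (suc j)
  X-mono ρ j m with ∈-++⁻ (vars (lhs ρ)) m
  ... | inj₁ m' = ∈-++⁺ˡ m'
  ... | inj₂ m' = ∈-++⁺ʳ (vars (lhs ρ)) (varsRhs-take-suc j (conds ρ) m')

  t∈X-next : ∀ (ρ : CRule F) pre s t rest {x} → conds ρ ≡ pre ++ (s , t) ∷ rest → x ∈ vars t → x ∈ X ρ (suc (length pre))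
  t∈X-next ρ pre s t rest ceq m rewrite ceq = ∈-++⁺ʳ (vars (lhs ρ)) (varsRhs-take-split pre s t rest m)

  Y-at : ∀ (ρ : CRule F) pre s t rest → conds ρ ≡ pre ++ (s , t) ∷ rest →
         Y ρ (length pre) ≡ vars (rhs ρ) ++ (vars t ++ []) ++ varsBoth rest
  Y-at ρ pre s t rest ceq rewrite ceq | drop-++ pre ((s , t) ∷ rest) | drop-++-∷ pre (s , t) rest = refl

  rhs∈Y : ∀ (ρ : CRule F) j {x} → x ∈ vars (rhs ρ) → x ∈ Y ρ j
  rhs∈Y ρ j = ∈-++⁺ˡ

  t∈Y : ∀ (ρ : CRule F) pre s t rest {x} → conds ρ ≡ pre ++ (s , t) ∷ rest → x ∈ vars t → x ∈ Y ρ (length pre)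
  t∈Y ρ pre s t rest ceq m rewrite Y-at ρ pre s t rest ceq = ∈-++⁺ʳ (vars (rhs ρ)) (∈-++⁺ˡ (∈-++⁺ˡ m))

  s-next∈Y : ∀ (ρ : CRule F) pre s t s' t' post {x} → conds ρ ≡ pre ++ (s , t) ∷ (s' , t') ∷ post →
             x ∈ vars s' → x ∈ Y ρ (length pre)
  s-next∈Y ρ pre s t s' t' post ceq m rewrite Y-at ρ pre s t _ ceq =
    ∈-++⁺ʳ (vars (rhs ρ)) (∈-++⁺ʳ (vars t ++ []) (∈-++⁺ˡ (∈-++⁺ˡ m)))

  Y-next⊆Y : ∀ (ρ : CRule F) pre s t s' t' post {x} → conds ρ ≡ pre ++ (s , t) ∷ (s' , t') ∷ post →
             x ∈ Y ρ (suc (length pre)) → x ∈ Y ρ (length pre)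
  Y-next⊆Y ρ pre s t s' t' post {x} ceq m =
    subst (x ∈_) (sym (Y-at ρ pre s t _ ceq)) (shrink (subst (x ∈_) Y-next m))
    where
    Y-next : Y ρ (suc (length pre)) ≡ vars (rhs ρ) ++ (vars t' ++ []) ++ varsBoth post
    Y-next = trans (cong (Y ρ) (sym (length-snoc pre (s , t))))
                   (Y-at ρ (pre ++ (s , t) ∷ []) s' t' post (trans ceq (sym (++-assoc pre _ _))))

    shrink : x ∈ vars (rhs ρ) ++ (vars t' ++ []) ++ varsBoth post →
             x ∈ vars (rhs ρ) ++ (vars t ++ []) ++ (vars s' ++ vars t') ++ varsBoth post
    shrink m with ∈-++⁻ (vars (rhs ρ)) m
    ... | inj₁ m₁ = ∈-++⁺ˡ m₁
    ... | inj₂ m₂ with ∈-++⁻ (vars t' ++ []) m₂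
    ...   | inj₁ m₃ = ∈-++⁺ʳ (vars (rhs ρ)) (∈-++⁺ʳ (vars t ++ [])
                        (∈-++⁺ˡ (∈-++⁺ʳ (vars s') (subst (x ∈_) (++-identityʳ (vars t')) m₃))))
    ...   | inj₂ m₄ = ∈-++⁺ʳ (vars (rhs ρ)) (∈-++⁺ʳ (vars t ++ []) (∈-++⁺ʳ (vars s' ++ vars t') m₄))

  ∈Z : ∀ (ρ : CRule F) j {x} → x ∈ X ρ j → x ∈ Y ρ j → x ∈ Z ρ j
  ∈Z ρ j mX mY = AnyP.deduplicate⁺ _≟_ (λ { refl p → p }) (∈-filter⁺ (λ y → y ∈? Y ρ j) mX mY)

  Z⊆X×Y : ∀ (ρ : CRule F) j {x} → x ∈ Z ρ j → x ∈ X ρ j × x ∈ Y ρ j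
  Z⊆X×Y ρ j m = ∈-filter⁻ (λ y → y ∈? Y ρ j) (AnyP.deduplicate⁻ _≟_ m)

module Soundness {F : Set} (R : CTRS F) where

  Holds : Subst → Term F × Term F → Set
  Holds σ c = R ⊢ (proj₁ c ⟨ σ ⟩) ⟶* (proj₂ c ⟨ σ ⟩)

  mutual
    step-level-suc : ∀ n {a b} → StepN R n a b → StepN R (suc n) a b
    step-level-suc (suc n) (p , c) = p , ctx-level-suc n c

    ctx-level-suc : ∀ n {p a b} → CtxAt (RootN R n) p a b → CtxAt (RootN R (suc n)) p a b
    ctx-level-suc n (root r)           = root (root-level-suc n r)
    ctx-level-suc n (arg f pre post c) = arg f pre post (ctx-level-suc n c)

    root-level-suc : ∀ n {a b} → RootN R n a b → RootN R (suc n) a b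
    root-level-suc n (ρ , σ , Rρ , e₁ , e₂ , cs) = ρ , σ , Rρ , e₁ , e₂ , conds-level-suc n cs

    conds-level-suc : ∀ n {σ} {cs : List (Term F × Term F)} →
                      All (λ c → Star (StepN R n) (proj₁ c ⟨ σ ⟩) (proj₂ c ⟨ σ ⟩)) cs →
                      All (λ c → Star (StepN R (suc n)) (proj₁ c ⟨ σ ⟩) (proj₂ c ⟨ σ ⟩)) cs
    conds-level-suc n []       = []
    conds-level-suc n (r ∷ rs) = steps-level-suc n r ∷ conds-level-suc n rs

    steps-level-suc : ∀ n {a b} → Star (StepN R n) a b → Star (StepN R (suc n)) a b
    steps-level-suc n ε       = ε
    steps-level-suc n (x ◅ s) = step-level-suc n x ◅ steps-level-suc n s

  step-level-mono : ∀ {m n} → m ≤ n → ∀ {a b} → StepN R m a b → StepN R n a b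
  step-level-mono m≤n = go (≤⇒≤′ m≤n)
    where
    go : ∀ {m n} → m ≤′ n → ∀ {a b} → StepN R m a b → StepN R n a b
    go (≤′-reflexive refl) s = s
    go (≤′-step m≤′n)      s = step-level-suc _ (go m≤′n s)

  steps-common-level : ∀ {a b} → R ⊢ a ⟶* b → ∃[ n ] Star (StepN R n) a b
  steps-common-level ε = zero , ε
  steps-common-level ((m , s) ◅ ss) with steps-common-level ss
  ... | n , ss' = m ⊔ n , step-level-mono (m≤m⊔n m n) s ◅ Star.map (step-level-mono (m≤n⊔m m n)) ss'

  conds-common-level : ∀ {σ} (cs : List (Term F × Term F)) → All (Holds σ) cs →
                       ∃[ n ] All (λ c → Star (StepN R n) (proj₁ c ⟨ σ ⟩) (proj₂ c ⟨ σ ⟩)) cs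
  conds-common-level []       []       = zero , []
  conds-common-level (c ∷ cs) (h ∷ hs) with steps-common-level h | conds-common-level cs hs
  ... | m , h' | n , hs' =
    m ⊔ n , Star.map (step-level-mono (m≤m⊔n m n)) h' ∷ All.map (Star.map (step-level-mono (m≤n⊔m m n))) hs'

  rule-step : ∀ ρ σ → R ρ → All (Holds σ) (conds ρ) → R ⊢ (lhs ρ ⟨ σ ⟩) ⟶ (rhs ρ ⟨ σ ⟩)
  rule-step ρ σ Rρ hs with conds-common-level (conds ρ) hs
  ... | n , hs' = suc n , [] , root (ρ , σ , Rρ , refl , refl , hs')

  arg-step : ∀ f pre post {u u'} → R ⊢ u ⟶ u' → R ⊢ fun f (pre ++ u ∷ post) ⟶ fun f (pre ++ u' ∷ post)
  arg-step f pre post (suc n , p , c) = suc n , length pre ∷ p , arg f pre post c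

  arg-steps : ∀ f pre post {u u'} → R ⊢ u ⟶* u' → R ⊢ fun f (pre ++ u ∷ post) ⟶* fun f (pre ++ u' ∷ post)
  arg-steps f pre post = Star.gmap (λ u → fun f (pre ++ u ∷ post)) (arg-step f pre post)

  mutual
    subst-steps : (t : Term F) {σ θ : Subst} → (∀ x → x ∈ vars t → R ⊢ σ x ⟶* θ x) → R ⊢ (t ⟨ σ ⟩) ⟶* (t ⟨ θ ⟩)
    subst-steps (var x)    h = h x (here refl)
    subst-steps (fun f ts) h = args-steps f [] ts h

    args-steps : ∀ f pre (ts : List (Term F)) {σ θ : Subst} → (∀ x → x ∈ varsL ts → R ⊢ σ x ⟶* θ x) →
                 R ⊢ fun f (pre ++ substL ts σ) ⟶* fun f (pre ++ substL ts θ)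
    args-steps f pre []       h = ε
    args-steps f pre (t ∷ ts) {σ} {θ} h =
      arg-steps f pre (substL ts σ) (subst-steps t (λ x m → h x (∈-++⁺ˡ m))) ◅◅
      subst₂ (λ a b → R ⊢ fun f a ⟶* fun f b) (++-assoc pre _ _) (++-assoc pre _ _)
             (args-steps f (pre ++ t ⟨ θ ⟩ ∷ []) ts (λ x m → h x (∈-++⁺ʳ (vars t) m)))

  TU : Set
  TU = Term (USym F)

  _⇂_ : (Pos → Set) → Pos → Pos → Set
  (B ⇂ p) q = B (p ++ q)

  NoneSafe : (Pos → Set) → Set
  NoneSafe B = ∀ q → ¬ B q

  Reduce* : List (Term F) → List (Term F) → Set
  Reduce* = Pointwise (R ⊢_⟶*_)

  -- The conditions cs hold for every substitution agreeing with σ on X_j.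
  -- This robustness lets σ be changed outside X_j when later conditions are met.
  ConditionsHold : CRule F → ℕ → Subst → List (Term F × Term F) → Set
  ConditionsHold ρ j σ cs = ∀ σ'' → (∀ x → x ∈ X ρ j → σ x ≡ σ'' x) → All (Holds σ'') cs

  -- Rel B u v : the term u of U_opt(R), whose EV-safe positions are B,
  -- simulates the R-term v.  RelL B k relates argument lists whose first
  -- argument sits at index k.
  data Rel : (Pos → Set) → TU → Term F → Set₁
  data RelL : (Pos → Set) → ℕ → List TU → List (Term F) → Set₁

  data Rel where
    frozen : ∀ {B u} → NoneSafe B → Rel B u (erase u)
    var≈   : ∀ {B x} → Rel B (var x) (var x)
    fun≈   : ∀ {B f us vs} → RelL B 0 us vs → Rel B (fun (inj₁ f) us) (fun f vs)
    -- U^ρ_j(us) simulates  lhs ρ ⟨σ⟩  when σ satisfies the first j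
    -- conditions and  s_j σ, σ(Z_j)  reduce to the terms vs simulated by us.
    U≈     : ∀ {B ρ j pre s t post σ us vs} → R ρ → conds ρ ≡ pre ++ (s , t) ∷ post → length pre ≡ j →
             ConditionsHold ρ j σ pre → Reduce* (s ⟨ σ ⟩ ∷ map σ (Z ρ j)) vs →
             RelL B 0 us vs → Rel B (fun (inj₂ (ρ , j)) us) (lhs ρ ⟨ σ ⟩)

  data RelL where
    []  : ∀ {B k} → RelL B k [] []
    _∷_ : ∀ {B k u v us vs} → Rel (B ⇂ (k ∷ [])) u v → RelL B (suc k) us vs → RelL B k (u ∷ us) (v ∷ vs)

  mutual
    Rel-mono : ∀ {B B' u v} → (∀ q → B' q → B q) → Rel B u v → Rel B' u v
    Rel-mono h (frozen none)     = frozen (λ q b → none q (h q b))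
    Rel-mono h var≈              = var≈
    Rel-mono h (fun≈ rs)         = fun≈ (RelL-mono (λ j q _ _ → h (j ∷ q)) rs)
    Rel-mono h (U≈ a b c d e rs) = U≈ a b c d e (RelL-mono (λ j q _ _ → h (j ∷ q)) rs)

    RelL-mono : ∀ {B B' k us vs} → (∀ j q → k ≤ j → j < k + length us → B' (j ∷ q) → B (j ∷ q)) →
                RelL B k us vs → RelL B' k us vs
    RelL-mono h [] = []
    RelL-mono {k = k} {us = u ∷ us} h (r ∷ rs) =
      Rel-mono (λ q → h k q ≤-refl (m<m+n k (s≤s z≤n))) r ∷
      RelL-mono (λ j q le lt → h j q (<⇒≤ le) (subst (j <_) (sym (+-suc k (length us))) lt)) rs

  Rel-at : ∀ (B : Pos → Set) (p : Pos) {a b u v} → a ≡ b → Rel (B ⇂ (a ∷ p)) u v → Rel (B ⇂ (b ∷ p)) u v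
  Rel-at B p refl r = r

  RelL-from : ∀ {B a b us vs} → a ≡ b → RelL B a us vs → RelL B b us vs
  RelL-from refl r = r

  mutual
    emb-related : ∀ {B} (t : Term F) → Rel B (emb t) t
    emb-related (var x)    = var≈
    emb-related (fun f ts) = fun≈ (embL-related ts)

    embL-related : ∀ {B k} (ts : List (Term F)) → RelL B k (embL ts) ts
    embL-related []       = []
    embL-related (t ∷ ts) = emb-related t ∷ embL-related ts

  mutual
    related-to-emb : ∀ {B v} (t : Term F) → Rel B (emb t) v → v ≡ t
    related-to-emb (var x)    (frozen _) = refl
    related-to-emb (var x)    var≈       = refl
    related-to-emb (fun f ts) (frozen _) = erase-emb (fun f ts)
    related-to-emb (fun f ts) (fun≈ rs)  = cong (fun f) (relatedL-to-embL ts rs)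

    relatedL-to-embL : ∀ {B k vs} (ts : List (Term F)) → RelL B k (embL ts) vs → vs ≡ ts
    relatedL-to-embL []       []       = refl
    relatedL-to-embL (t ∷ ts) (r ∷ rs) = cong₂ _∷_ (related-to-emb t r) (relatedL-to-embL ts rs)

  Matches : (Pos → Set) → TU → (ℕ → TU) → Subst → Set₁
  Matches B l τ θ = ∀ p x → l ∣ p ≡ just (var x) → Rel (B ⇂ p) (τ x) (θ x)

  MatchesL : (Pos → Set) → ℕ → List TU → (ℕ → TU) → Subst → Set₁
  MatchesL B k ls τ θ = ∀ i p x → argAt ls i p ≡ just (var x) → Rel (B ⇂ ((k + i) ∷ p)) (τ x) (θ x)

  ErasedOff : List ℕ → (ℕ → TU) → Subst → Set
  ErasedOff xs τ θ = ∀ x → x ∉ xs → θ x ≡ erase (τ x)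

  mutual
    decompose : ∀ {B v} (L : Term F) (τ : ℕ → TU) → Linear (emb L) → Rel B (emb L ⟨ τ ⟩) v →
                Σ Subst λ θ → v ≡ L ⟨ θ ⟩ × Matches B (emb L) τ θ × ErasedOff (vars (emb L)) τ θ
    decompose {B} {v} (var y) τ _ r = θ , θy , match , off
      where
      θ : Subst
      θ x with x ≟ y
      ... | yes _ = v
      ... | no _  = erase (τ x)
      θy : v ≡ θ y
      θy with y ≟ y
      ... | yes _  = refl
      ... | no y≢y = ⊥-elim (y≢y refl)
      match : Matches B (var y) τ θ
      match [] x refl = subst (Rel B (τ y)) θy r
      off : ErasedOff (y ∷ []) τ θ
      off x x∉ with x ≟ y
      ... | yes refl = ⊥-elim (x∉ (here refl))
      ... | no _     = refl
    decompose (fun f Ls) τ _ (frozen none) =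
      (λ x → erase (τ x)) , erase-subst (fun f Ls) τ , (λ p x _ → frozen (λ q → none (p ++ q))) , (λ _ _ → refl)
    decompose {B} (fun f Ls) τ lin (fun≈ rs) with decomposeL Ls τ lin rs
    ... | θ , e , match , off = θ , cong (fun f) e , (λ { (i ∷ p) x e' → match i p x e' }) , off

    decomposeL : ∀ {B k vs} (Ls : List (Term F)) (τ : ℕ → TU) → Unique (varsL (embL Ls)) →
                 RelL B k (substL (embL Ls) τ) vs →
                 Σ Subst λ θ → vs ≡ substL Ls θ × MatchesL B k (embL Ls) τ θ × ErasedOff (varsL (embL Ls)) τ θ
    decomposeL [] τ _ [] = (λ x → erase (τ x)) , refl , (λ i p x ()) , (λ _ _ → refl)
    decomposeL {B} {k} (L ∷ Ls) τ lin (r ∷ rs)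
      with decompose L τ (unique-++ˡ (vars (emb L)) lin) r | decomposeL Ls τ (unique-++ʳ (vars (emb L)) lin) rs
    ... | θ₁ , e₁ , match₁ , off₁ | θ₂ , e₂ , match₂ , off₂ = θ , cong₂ _∷_ e₁' e₂' , match , off
      where
      -- the pattern is linear, so θ₁ and θ₂ can be glued
      θ : Subst
      θ x with x ∈? vars (emb L)
      ... | yes _ = θ₁ x
      ... | no _  = θ₂ x
      θ₁≡θ : ∀ x → x ∈ vars (emb L) → θ₁ x ≡ θ x
      θ₁≡θ x m with x ∈? vars (emb L)
      ... | yes _  = refl
      ... | no  m' = ⊥-elim (m' m)
      θ₂≡θ : ∀ x → x ∈ varsL (embL Ls) → θ₂ x ≡ θ x
      θ₂≡θ x m with x ∈? vars (emb L)
      ... | yes m' = ⊥-elim (unique-disjoint (vars (emb L)) lin m' m)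
      ... | no _   = refl
      e₁' = trans e₁ (subst-agree L (λ x m → θ₁≡θ x (subst (x ∈_) (sym (vars-emb L)) m)))
      e₂' = trans e₂ (substL-agree Ls (λ x m → θ₂≡θ x (subst (x ∈_) (sym (varsL-embL Ls)) m)))
      match : MatchesL B k (emb L ∷ embL Ls) τ θ
      match zero    p x e = Rel-at B p (sym (+-identityʳ k))
        (subst (Rel (B ⇂ (k ∷ p)) (τ x)) (θ₁≡θ x (var-position⇒∈vars (emb L) p e)) (match₁ p x e))
      match (suc i) p x e = Rel-at B p (sym (+-suc k i))
        (subst (Rel (B ⇂ (suc (k + i) ∷ p)) (τ x)) (θ₂≡θ x (var-argAt⇒∈varsL (embL Ls) i p e)) (match₂ i p x e))
      off : ErasedOff (vars (emb L) ++ varsL (embL Ls)) τ θ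
      off x x∉ with x ∈? vars (emb L)
      ... | yes m = ⊥-elim (x∉ (∈-++⁺ˡ m))
      ... | no _  = off₂ x (λ m → x∉ (∈-++⁺ʳ (vars (emb L)) m))

  mutual
    compose : ∀ {B : Pos → Set} (r : Term F) (τ : ℕ → TU) (θ : Subst) →
              (∀ p x → emb r ∣ p ≡ just (var x) → Rel (B ⇂ p) (τ x) (θ x)) → Rel B (emb r ⟨ τ ⟩) (r ⟨ θ ⟩)
    compose (var y)    τ θ h = h [] y refl
    compose (fun f rs) τ θ h = fun≈ (composeL 0 rs τ θ (λ i p x e → h (i ∷ p) x e))

    composeL : ∀ {B : Pos → Set} k (rs : List (Term F)) (τ : ℕ → TU) (θ : Subst) →
               (∀ i p x → argAt (embL rs) i p ≡ just (var x) → Rel (B ⇂ ((k + i) ∷ p)) (τ x) (θ x)) →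
               RelL B k (substL (embL rs) τ) (substL rs θ)
    composeL k []       τ θ h = []
    composeL {B} k (r ∷ rs) τ θ h =
      compose r τ θ (λ p x e → Rel-at B p (+-identityʳ k) (h 0 p x e)) ∷
      composeL (suc k) rs τ θ (λ i p x e → Rel-at B p (+-suc k i) (h (suc i) p x e))

  nextB-other-arg : ∀ {B : Pos → Set} {i j : ℕ} {p q : Pos} {l r : TU} → ¬ j ≡ i →
                    nextB B (i ∷ p) l r (j ∷ q) → B (j ∷ q)
  nextB-other-arg j≢i (inj₁ (b , _))                     = b
  nextB-other-arg j≢i (inj₂ (inj₁ (_ , e , _)))          = ⊥-elim (j≢i (proj₁ (∷-injective e)))
  nextB-other-arg j≢i (inj₂ (inj₂ (_ , _ , _ , e , _)))  = ⊥-elim (j≢i (proj₁ (∷-injective e)))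

  nextB-same-arg : ∀ {B : Pos → Set} {i : ℕ} {p q : Pos} {l r : TU} →
                   nextB B (i ∷ p) l r (i ∷ q) → nextB (B ⇂ (i ∷ [])) p l r q
  nextB-same-arg {i = i} (inj₁ (b , p≰q)) = inj₁ (b , λ { (d , e) → p≰q (d , cong (i ∷_) e) })
  nextB-same-arg (inj₂ (inj₁ (q' , e , f))) = inj₂ (inj₁ (q' , proj₂ (∷-injective e) , f))
  nextB-same-arg (inj₂ (inj₂ (pv , p' , q' , e , b , v , eq))) =
    inj₂ (inj₂ (pv , p' , q' , proj₂ (∷-injective e) , b , v , eq))

  nextB-root-shared-var : ∀ {B : Pos → Set} (l r : TU) (p' pv : Pos) {x : ℕ} → Linear l →
                          r ∣ p' ≡ just (var x) → l ∣ pv ≡ just (var x) → ∀ q → nextB B [] l r (p' ++ q) → B (pv ++ q)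
  nextB-root-shared-var l r p' pv lin e epv q (inj₁ (_ , p≰q)) = ⊥-elim (p≰q (p' ++ q , refl))
  nextB-root-shared-var l r p' pv lin e epv q (inj₂ (inj₁ (q' , e₂ , (f , us , ef)))) =
    ⊥-elim (no-fun-below-var r p' q e (subst (λ z → r ∣ z ≡ just (fun f us)) (sym e₂) ef))
  nextB-root-shared-var l r p' pv lin e epv q (inj₂ (inj₂ (pv₂ , p₂ , q₂ , e₂ , b , (y , ey) , eq)))
    with var-occurrences-aligned r p' q p₂ q₂ e (trans (sym eq) ey) e₂
  ... | refl , refl , refl with linear-position-unique l pv pv₂ lin epv ey
  ... | refl = b

  -- Below an extra variable of a rule nothing is safe after the step:
  -- this is what EV-safety buys.
  nextB-root-extra-var : ∀ {B : Pos → Set} (l r : TU) (p' : Pos) {x : ℕ} → r ∣ p' ≡ just (var x) →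
                         x ∉ vars l → NoneSafe (nextB B [] l r ⇂ p')
  nextB-root-extra-var l r p' e x∉ q (inj₁ (_ , p≰q)) = p≰q (p' ++ q , refl)
  nextB-root-extra-var l r p' e x∉ q (inj₂ (inj₁ (q' , e₂ , (f , us , ef)))) =
    no-fun-below-var r p' q e (subst (λ z → r ∣ z ≡ just (fun f us)) (sym e₂) ef)
  nextB-root-extra-var l r p' e x∉ q (inj₂ (inj₂ (pv₂ , p₂ , q₂ , e₂ , b , (y , ey) , eq)))
    with var-occurrences-aligned r p' q p₂ q₂ e (trans (sym eq) ey) e₂
  ... | refl , refl , refl = x∉ (var-position⇒∈vars l pv₂ ey)

  root-step-vars : ∀ {B : Pos → Set} (l r : TU) (τ : ℕ → TU) (θ : Subst) → Linear l →
                   Matches B l τ θ → ErasedOff (vars l) τ θ →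
                   ∀ p' x → r ∣ p' ≡ just (var x) → Rel (nextB B [] l r ⇂ p') (τ x) (θ x)
  root-step-vars {B} l r τ θ lin match off p' x e with x ∈? vars l
  ... | yes m = let pv , epv = ∈vars⇒var-position l m in
                Rel-mono (nextB-root-shared-var {B = B} l r p' pv lin e epv) (match pv x epv)
  ... | no x∉ = subst (Rel (nextB B [] l r ⇂ p') (τ x)) (sym (off x x∉))
                      (frozen (nextB-root-extra-var {B = B} l r p' e x∉))

  RelL-split : ∀ {B : Pos → Set} {k} (pre : List TU) {u post vs} → RelL B k (pre ++ u ∷ post) vs →
               Σ (List (Term F)) λ vpre → Σ (Term F) λ v → Σ (List (Term F)) λ vpost →
               vs ≡ vpre ++ v ∷ vpost × RelL B k pre vpre × Rel (B ⇂ ((k + length pre) ∷ [])) u v ×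
               RelL B (suc (k + length pre)) post vpost
  RelL-split {B} {k} [] (r ∷ rs) =
    [] , _ , _ , refl , [] , Rel-at B [] (sym (+-identityʳ k)) r , RelL-from (cong suc (sym (+-identityʳ k))) rs
  RelL-split {B} {k} (_ ∷ pre) (r ∷ rs) with RelL-split pre rs
  ... | vpre , v , vpost , refl , rpre , ru , rpost =
    _ ∷ vpre , v , vpost , refl , r ∷ rpre , Rel-at B [] (sym (+-suc k (length pre))) ru ,
    RelL-from (cong suc (sym (+-suc k (length pre)))) rpost

  RelL-join : ∀ {B : Pos → Set} {k} (pre : List TU) {u post vpre v vpost} → RelL B k pre vpre →
              Rel (B ⇂ ((k + length pre) ∷ [])) u v → RelL B (suc (k + length pre)) post vpost →
              RelL B k (pre ++ u ∷ post) (vpre ++ v ∷ vpost)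
  RelL-join {B} {k} [] [] ru rpost =
    Rel-at B [] (+-identityʳ k) ru ∷ RelL-from (cong suc (+-identityʳ k)) rpost
  RelL-join {B} {k} (_ ∷ pre) (r ∷ rpre) ru rpost =
    r ∷ RelL-join pre rpre (Rel-at B [] (+-suc k (length pre)) ru) (RelL-from (cong suc (+-suc k (length pre))) rpost)

  Reduce*-extend : ∀ {as} (vpre : List (Term F)) {v v' vpost} →
                   Reduce* as (vpre ++ v ∷ vpost) → R ⊢ v ⟶* v' → Reduce* as (vpre ++ v' ∷ vpost)
  Reduce*-extend []         (h ∷ hs) h' = (h ◅◅ h') ∷ hs
  Reduce*-extend (_ ∷ vpre) (h ∷ hs) h' = h ∷ Reduce*-extend vpre hs h'

  Reduce*-vars⁺ : ∀ (zs : List ℕ) (σ θ : Subst) → (∀ x → x ∈ zs → R ⊢ σ x ⟶* θ x) →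
                  Reduce* (map σ zs) (substL (map var zs) θ)
  Reduce*-vars⁺ []       σ θ h = []
  Reduce*-vars⁺ (z ∷ zs) σ θ h = h z (here refl) ∷ Reduce*-vars⁺ zs σ θ (λ x m → h x (there m))

  Reduce*-vars⁻ : ∀ (zs : List ℕ) (σ θ : Subst) → Reduce* (map σ zs) (substL (map var zs) θ) →
                  ∀ x → x ∈ zs → R ⊢ σ x ⟶* θ x
  Reduce*-vars⁻ (z ∷ zs) σ θ (h ∷ hs) x (here refl) = h
  Reduce*-vars⁻ (z ∷ zs) σ θ (h ∷ hs) x (there m)   = Reduce*-vars⁻ zs σ θ hs x m

  decompose-U-args : ∀ {B vs} (t : Term F) (zs : List ℕ) (τ : ℕ → TU) →
                     Unique (varsL (emb t ∷ map var zs)) → RelL B 0 (substL (emb t ∷ map var zs) τ) vs →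
                     Σ Subst λ θ → vs ≡ substL (t ∷ map var zs) θ × MatchesL B 0 (emb t ∷ map var zs) τ θ ×
                                  ErasedOff (varsL (emb t ∷ map var zs)) τ θ
  decompose-U-args t zs τ lin rs rewrite sym (embL-map-var {F} zs) = decomposeL (t ∷ map var zs) τ lin rs

  compose-U-args : ∀ {B : Pos → Set} (s : Term F) (zs : List ℕ) (τ : ℕ → TU) (θ : Subst) →
                   (∀ i p x → argAt (emb s ∷ map var zs) i p ≡ just (var x) → Rel (B ⇂ (i ∷ p)) (τ x) (θ x)) →
                   RelL B 0 (substL (emb s ∷ map var zs) τ) (substL (s ∷ map var zs) θ)
  compose-U-args s zs τ θ h rewrite sym (embL-map-var {F} zs) = composeL 0 (s ∷ map var zs) τ θ h

  -- When a rule  U^ρ_j(t_j, Z_j) → …  fires on a term simulating  lhs ρ ⟨σ⟩,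
  -- the j-th condition is met: matching yields θ with  s_j σ →* t_j θ.  The
  -- substitution σ' (σ on X_j, θ elsewhere) leaves lhs ρ unchanged, satisfies
  -- the first j+1 conditions, and reduces to θ on every variable still needed.
  module ConditionMet {B : Pos → Set} {ρ : CRule F} (det : Deterministic ρ) {pre s t rest}
                      (ceq : conds ρ ≡ pre ++ (s , t) ∷ rest) (τ : ℕ → TU) (σ : Subst)
                      (holds : ConditionsHold ρ (length pre) σ pre)
                      {vs : List (Term F)} (red : Reduce* (s ⟨ σ ⟩ ∷ map σ (Z ρ (length pre))) vs)
                      (lin : Linear (U ρ (length pre) t))
                      (rs : RelL B 0 (substL (emb t ∷ map var (Z ρ (length pre))) τ) vs) where

    private
      j = length pre
      matched = decompose-U-args t (Z ρ j) τ lin rs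

    θ : Subst
    θ = proj₁ matched

    match : Matches B (U ρ j t) τ θ
    match (i ∷ p) x e = proj₁ (proj₂ (proj₂ matched)) i p x e

    off : ErasedOff (vars (U ρ j t)) τ θ
    off = proj₂ (proj₂ (proj₂ matched))

    private
      red' : Reduce* (s ⟨ σ ⟩ ∷ map σ (Z ρ j)) (t ⟨ θ ⟩ ∷ substL (map var (Z ρ j)) θ)
      red' = subst (Reduce* _) (proj₁ (proj₂ matched)) red

      s→t : R ⊢ (s ⟨ σ ⟩) ⟶* (t ⟨ θ ⟩)
      s→t = Pointwise.head red'

      Z-steps : ∀ x → x ∈ Z ρ j → R ⊢ σ x ⟶* θ x
      Z-steps = Reduce*-vars⁻ (Z ρ j) σ θ (Pointwise.tail red')

      -- linearity of U^ρ_j(t_j, Z_j): the variables of t_j are fresh for X_j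
      t-fresh : ∀ {x} → x ∈ vars t → x ∉ X ρ j
      t-fresh {x} m mX = unique-disjoint (vars t) lin' m (∈Z ρ j mX (t∈Y ρ pre s t rest ceq m))
        where
        lin' : Unique (vars t ++ Z ρ j)
        lin' = subst₂ (λ a b → Unique (a ++ b)) (vars-emb t) (varsL-map-var (Z ρ j)) lin

    σ' : Subst
    σ' x with x ∈? X ρ j
    ... | yes _ = σ x
    ... | no _  = θ x

    private
      σ'-X : ∀ {x} → x ∈ X ρ j → σ' x ≡ σ x
      σ'-X {x} mX with x ∈? X ρ j
      ... | yes _  = refl
      ... | no x∉X = ⊥-elim (x∉X mX)

      σ'-t : ∀ {x} → x ∈ vars t → σ' x ≡ θ x
      σ'-t {x} m with x ∈? X ρ j
      ... | yes mX = ⊥-elim (t-fresh m mX)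
      ... | no _   = refl

    σ'-steps : ∀ x → (x ∈ X ρ j → x ∈ Y ρ j) → R ⊢ σ' x ⟶* θ x
    σ'-steps x X⇒Y with x ∈? X ρ j
    ... | yes mX = Z-steps x (∈Z ρ j mX (X⇒Y mX))
    ... | no _   = ε

    lhs-unchanged : lhs ρ ⟨ σ ⟩ ≡ lhs ρ ⟨ σ' ⟩
    lhs-unchanged = subst-agree (lhs ρ) (λ x m → sym (σ'-X (∈-++⁺ˡ m)))

    holds-next : ConditionsHold ρ (suc j) σ' (pre ++ (s , t) ∷ [])
    holds-next σ'' agree = AllP.++⁺ (holds σ'' agree-X) (s→t' ∷ [])
      where
      agree-X : ∀ x → x ∈ X ρ j → σ x ≡ σ'' x
      agree-X x mX = trans (sym (σ'-X mX)) (agree x (X-mono ρ j mX))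

      -- determinism: the variables of s_j lie in X_j
      s→t' : Holds σ'' (s , t)
      s→t' = subst₂ (λ a b → R ⊢ a ⟶* b)
        (subst-agree s (λ x m → agree-X x (det pre s t rest ceq x m)))
        (subst-agree t (λ x m → trans (sym (σ'-t m)) (agree x (t∈X-next ρ pre s t rest ceq m))))
        s→t

  Simulated : (Pos → Set) → TU → Term F → Set₁
  Simulated B' u' v = Σ (Term F) λ v' → R ⊢ v ⟶* v' × Rel B' u' v'

  root-unconditional : ∀ {B : Pos → Set} {ρ v} (τ : ℕ → TU) → R ρ → conds ρ ≡ [] → Linear (emb (lhs ρ)) →
                       Rel B (emb (lhs ρ) ⟨ τ ⟩) v → Simulated (nextB B [] (emb (lhs ρ)) (emb (rhs ρ))) (emb (rhs ρ) ⟨ τ ⟩) v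
  root-unconditional {B} {ρ} τ Rρ ceq lin r with decompose (lhs ρ) τ lin r
  ... | θ , refl , match , off =
    rhs ρ ⟨ θ ⟩ ,
    rule-step ρ θ Rρ (subst (All (Holds θ)) (sym ceq) []) ◅ ε ,
    compose (rhs ρ) τ θ (root-step-vars {B = B} (emb (lhs ρ)) (emb (rhs ρ)) τ θ lin match off)

  -- Entering the first condition takes no R-step.
  root-first : ∀ {B : Pos → Set} {ρ v} (τ : ℕ → TU) s t post → R ρ → conds ρ ≡ (s , t) ∷ post →
               Linear (emb (lhs ρ)) → Rel B (emb (lhs ρ) ⟨ τ ⟩) v →
               Simulated (nextB B [] (emb (lhs ρ)) (U ρ 0 s)) (U ρ 0 s ⟨ τ ⟩) v
  root-first {B} {ρ} τ s t post Rρ ceq lin r with decompose (lhs ρ) τ lin r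
  ... | θ , refl , match , off =
    lhs ρ ⟨ θ ⟩ , ε ,
    U≈ {pre = []} Rρ ceq refl (λ _ _ → [])
       (ε ∷ Reduce*-vars⁺ (Z ρ 0) θ θ (λ _ _ → ε))
       (compose-U-args s (Z ρ 0) τ θ (λ i p x e → root-step-vars {B = B} (emb (lhs ρ)) (U ρ 0 s) τ θ lin match off (i ∷ p) x e))

  -- Passing from condition j to condition j+1 takes no R-step either.
  root-mid : ∀ {B : Pos → Set} {ρ v} (τ : ℕ → TU) pre s t s' t' post → R ρ → Deterministic ρ →
             conds ρ ≡ pre ++ (s , t) ∷ (s' , t') ∷ post → Linear (U ρ (length pre) t) → B [] →
             Rel B (U ρ (length pre) t ⟨ τ ⟩) v →
             Simulated (nextB B [] (U ρ (length pre) t) (U ρ (suc (length pre)) s')) (U ρ (suc (length pre)) s' ⟨ τ ⟩) v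
  root-mid τ pre s t s' t' post Rρ det ceq lin b (frozen none) = ⊥-elim (none [] b)
  root-mid {B} {ρ} τ pre s t s' t' post Rρ det ceq lin b (U≈ {pre = pre₀} {σ = σ} _ ceq₀ jeq holds red rs)
    with split-unique pre₀ pre (trans (sym ceq₀) ceq) jeq
  ... | refl , refl , refl =
    lhs ρ ⟨ σ ⟩ , ε ,
    subst (Rel _ _) (sym lhs-unchanged)
      (U≈ {pre = pre ++ (s , t) ∷ []} Rρ (trans ceq (sym (++-assoc pre _ _))) (length-snoc pre (s , t)) holds-next
          (subst-steps s' (λ x m → σ'-steps x (λ _ → s-next∈Y ρ pre s t s' t' post ceq m)) ∷
           Reduce*-vars⁺ (Z ρ (suc j)) σ' θ
             (λ x m → σ'-steps x (λ _ → Y-next⊆Y ρ pre s t s' t' post ceq (proj₂ (Z⊆X×Y ρ (suc j) m)))))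
          (compose-U-args s' (Z ρ (suc j)) τ θ
             (λ i p x e → root-step-vars {B = B} (U ρ j t) (U ρ (suc j) s') τ θ lin match off (i ∷ p) x e)))
    where
    j = length pre
    open ConditionMet {B} {ρ} det ceq τ σ holds red lin rs

  -- Leaving the last condition is simulated by the conditional rule ρ itself.
  root-last : ∀ {B : Pos → Set} {ρ v} (τ : ℕ → TU) pre s t → R ρ → Deterministic ρ →
              conds ρ ≡ pre ++ (s , t) ∷ [] → Linear (U ρ (length pre) t) → B [] →
              Rel B (U ρ (length pre) t ⟨ τ ⟩) v →
              Simulated (nextB B [] (U ρ (length pre) t) (emb (rhs ρ))) (emb (rhs ρ) ⟨ τ ⟩) v
  root-last τ pre s t Rρ det ceq lin b (frozen none) = ⊥-elim (none [] b)
  root-last {B} {ρ} τ pre s t Rρ det ceq lin b (U≈ {pre = pre₀} {σ = σ} _ ceq₀ jeq holds red rs)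
    with split-unique pre₀ pre (trans (sym ceq₀) ceq) jeq
  ... | refl , refl , refl =
    rhs ρ ⟨ θ ⟩ ,
    subst (λ a → R ⊢ a ⟶* (rhs ρ ⟨ θ ⟩)) (sym lhs-unchanged)
      (rule-step ρ σ' Rρ (subst (All (Holds σ')) (sym ceq) (holds-next σ' (λ _ _ → refl))) ◅
       subst-steps (rhs ρ) (λ x m → σ'-steps x (λ _ → rhs∈Y ρ (length pre) m))) ,
    compose (rhs ρ) τ θ (root-step-vars {B = B} (U ρ (length pre) t) (emb (rhs ρ)) τ θ lin match off)
    where
    open ConditionMet {B} {ρ} det ceq τ σ holds red lin rs

  module _ (det : IsEDCTRS R) (ll : UoptLL R) where

    simulate-root : ∀ {B : Pos → Set} {l r : TU} {v} (τ : ℕ → TU) → Uopt R l r → B [] →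
                    Rel B (l ⟨ τ ⟩) v → Simulated (nextB B [] l r) (r ⟨ τ ⟩) v
    simulate-root τ rule@(keep Rρ ceq)                    b = root-unconditional τ Rρ ceq (ll _ _ rule)
    simulate-root τ rule@(first s t post Rρ ceq)          b = root-first τ s t post Rρ ceq (ll _ _ rule)
    simulate-root τ rule@(mid pre s t s' t' post Rρ ceq) b =
      root-mid τ pre s t s' t' post Rρ (det _ Rρ) ceq (ll _ _ rule) b
    simulate-root τ rule@(last pre s t Rρ ceq)            b = root-last τ pre s t Rρ (det _ Rρ) ceq (ll _ _ rule) b

    other-args-unchanged : ∀ {B : Pos → Set} {i p} {l r : TU} k {us vs} →
                           (∀ j → k ≤ j → j < k + length us → ¬ j ≡ i) →
                           RelL B k us vs → RelL (nextB B (i ∷ p) l r) k us vs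
    other-args-unchanged {B} k avoid = RelL-mono (λ j q le lt → nextB-other-arg {B = B} (avoid j le lt))

    mutual
      simulate-step : ∀ {B : Pos → Set} {u u' v p} {l r : TU} → Uopt R l r → StepAt p l r u u' → B p →
                      Rel B u v → Simulated (nextB B p l r) u' v
      simulate-step rule (root (τ , refl , refl)) b r = simulate-root τ rule b r
      simulate-step rule (arg f pre post st)      b r = simulate-in-arg rule pre post st b r

      -- a step inside an argument is simulated inside the corresponding
      -- argument; below a U-symbol it only extends the recorded reductions
      simulate-in-arg : ∀ {B : Pos → Set} {f u₀ u₀' v p} {l r : TU} → Uopt R l r → (pre post : List TU) →
                        StepAt p l r u₀ u₀' → B (length pre ∷ p) → Rel B (fun f (pre ++ u₀ ∷ post)) v →
                        Simulated (nextB B (length pre ∷ p) l r) (fun f (pre ++ u₀' ∷ post)) v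
      simulate-in-arg rule pre post st b (frozen none) = ⊥-elim (none _ b)
      simulate-in-arg {B} {inj₁ g} rule pre post st b (fun≈ rs) with RelL-split pre rs
      ... | vpre , v₀ , vpost , refl , rpre , r₀ , rpost with simulate-step rule st b r₀
      ... | v₀' , v₀→v₀' , r₀' =
        fun g (vpre ++ v₀' ∷ vpost) , arg-steps g vpre vpost v₀→v₀' ,
        fun≈ (updated-args B pre post rpre r₀' rpost)
      simulate-in-arg {B} {inj₂ _} rule pre post st b (U≈ Rρ ceq jeq holds red rs) with RelL-split pre rs
      ... | vpre , v₀ , vpost , refl , rpre , r₀ , rpost with simulate-step rule st b r₀
      ... | v₀' , v₀→v₀' , r₀' =
        _ , ε , U≈ Rρ ceq jeq holds (Reduce*-extend vpre red v₀→v₀') (updated-args B pre post rpre r₀' rpost)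

      updated-args : ∀ (B : Pos → Set) {p} {l r : TU} (pre post : List TU) {u vpre v vpost} →
                     RelL B 0 pre vpre → Rel (nextB (B ⇂ (length pre ∷ [])) p l r) u v →
                     RelL B (suc (length pre)) post vpost →
                     RelL (nextB B (length pre ∷ p) l r) 0 (pre ++ u ∷ post) (vpre ++ v ∷ vpost)
      updated-args B pre post rpre r rpost =
        RelL-join pre (other-args-unchanged 0 (λ j _ lt → <⇒≢ lt) rpre)
                      (Rel-mono (λ q → nextB-same-arg {B = B}) r)
                      (other-args-unchanged (suc (length pre)) (λ j le _ → >⇒≢ le) rpost)

    simulate-run : ∀ {B : Pos → Set} {u w v} → EVS (Uopt R) B u w → Rel B u v →
                   Σ (Term F) λ v' → R ⊢ v ⟶* v' × Σ (Pos → Set) λ B' → Rel B' w v'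
    simulate-run done r = _ , ε , _ , r
    simulate-run (step p l r rule st b evs) rel with simulate-step rule st b rel
    ... | v₁ , v→v₁ , rel₁ with simulate-run evs rel₁
    ... | v₂ , v₁→v₂ , B₂ , rel₂ = v₂ , v→v₁ ◅◅ v₁→v₂ , B₂ , rel₂

-- Theorem 4.17: simulate the EV-safe sequence starting from  emb s,
-- which simulates s; the final term  emb t  can only simulate t itself.

open Soundness using (emb-related; related-to-emb; simulate-run)

theorem4p17 : {F : Set} (R : CTRS F) → IsEDCTRS R → UoptLL R → NonLV R ⊎ NonRV R →
    (s t : Term F) → Uopt R ⊢ emb s ⟶*evs emb t → R ⊢ s ⟶* t
theorem4p17 R det ll _ s t evs with simulate-run R det ll evs (emb-related R s)
... | v , s→v , _ , t≈v = subst (R ⊢ s ⟶*_) (related-to-emb R t t≈v) s→v
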